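{- Let $a,b,c\ge 1$ be integers and $n=a+b+c+2$. Every graph returned by the Stopping Game Generator with parameters $(a,b,c)$ (described in the context) is a Stopping Game.
   Context: A simple stochastic game (SSG) is a finite directed graph whose nodes are of four types: max, min, average and terminal, with exactly two terminal nodes terminal-0 and terminal-1 having no out-arcs, and every max, min and average node having exactly two out-arcs. For a max strategy $\sigma$ (choice of one out-arc at each max node) and min strategy $\tau$ (choice of one out-arc at each min node), $G_{\sigma,\tau}$ is the subgraph keeping only the chosen arcs at max and min nodes and both arcs at average nodes. An SSG is a Stopping Game if for every $(\sigma,\tau)$ and every node $v$ there is a path in $G_{\sigma,\tau}$ from $v$ to a terminal. For a directed graph $H$ with typed nodes (possibly with some max/min nodes having only one out-arc), a bad subgraph is a nonempty node set $S$ such that every max node and every min node in $S$ has at least one out-arc with head in $S$, every average node in $S$ has all its out-arcs with heads in $S$, $S$ contains no terminal, and any node of $S$ can reach any other node of $S$ by a path inside $S$. Stopping Game Generator with parameters $(a,b,c)$: (1) Number nodes $1,\dots,n$; nodes $n-1$ and $n$ are terminal-0 and terminal-1; node $n-2$ is an average node; the numbers $1,\dots,n-3$ are assigned uniformly at random to $a-1$ average nodes, $b$ min nodes and $c$ max nodes. (2) For each non-terminal node $v$, choose uniformly at random a node $w$ with larger number than $v$ and add the arc $(v,w)$. (3) While some average node has exactly one out-arc: choose such a node $m$ uniformly at random, let $(m,p)$ be its out-arc, choose uniformly at random a node $q\notin\{m,p\}$ and add the arc $(m,q)$. (4) While some max or min node has exactly one out-arc: choose such a node $m$ uniformly at random,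 let $(m,p)$ be its out-arc, let $Q$ be the set of non-terminal nodes $q\notin\{m,p\}$ such that adding the arc $(m,q)$ to the current graph does not create a bad subgraph, choose $q\in Q$ uniformly at random and add the arc $(m,q)$. (5) Return the constructed graph. -}

module Defs where

open import Data.Nat using (ℕ; _+_; _∸_; _<ᵇ_; _<_)
open import Data.Bool using (Bool; true; false; _∧_)
open import Data.Fin using (Fin; toℕ; _≟_)
open import Data.Fin.Subset using (Subset; _∈_)
open import Data.List using (List; []; _∷_; _++_; length; filterᵇ; allFin)
open import Data.List.Membership.Propositional renaming (_∈_ to _∈L_)
open import Data.List.Relation.Unary.All using (All)
open import Data.List.Relation.Unary.Any using (Any)
open import Data.Product using (Σ; ∃; _×_; _,_; proj₁)
open import Data.Sum using (_⊎_)
open import Relation.Nullary using (¬_; yes; no)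
open import Relation.Binary.PropositionalEquality using (_≡_; _≢_)
open import Relation.Binary.Construct.Closure.ReflexiveTransitive using (Star)

data NodeType : Set where
  maxN minN avgN term0 term1 : NodeType

IsTerminal : NodeType → Set
IsTerminal t = t ≡ term0 ⊎ t ≡ term1

IsPlayer : NodeType → Set
IsPlayer t = t ≡ maxN ⊎ t ≡ minN

isAvg isMin isMax : NodeType → Bool
isAvg avgN = true
isAvg _ = false
isMin minN = true
isMin _ = false
isMax maxN = true
isMax _ = false

-- Nodes are Fin n; index k (0-based) stands for the paper's node k+1.
-- A (multi)graph on typed nodes: type map and out-arc lists (heads of out-arcs).
Types : ℕ → Set
Types n = Fin n → NodeType

Arcs : ℕ → Set
Arcs n = Fin n → List (Fin n)

addArc : ∀ {n} → Arcs n → Fin n → Fin n → Arcs n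
addArc A m q v with v ≟ m
... | yes _ = A v ++ (q ∷ [])
... | no _ = A v

EdgeIn : ∀ {n} → Arcs n → Subset n → Fin n → Fin n → Set
EdgeIn A S u w = u ∈ S × w ∈ S × w ∈L A u

IsBad : ∀ {n} → Types n → Arcs n → Subset n → Set
IsBad {n} T A S =
  (∃ λ v → v ∈ S) ×
  ((v : Fin n) → v ∈ S →
      (IsPlayer (T v) → Any (λ w → w ∈ S) (A v)) ×
      (T v ≡ avgN → All (λ w → w ∈ S) (A v)) ×
      ¬ IsTerminal (T v)) ×
  ((u w : Fin n) → u ∈ S → w ∈ S → Star (EdgeIn A S) u w)

NoBadSubgraph : ∀ {n} → Types n → Arcs n → Set
NoBadSubgraph {n} T A = ¬ (Σ (Subset n) λ S → IsBad T A S)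

record Graph (n : ℕ) : Set where
  constructor graph
  field
    type : Types n
    arcs : Arcs n
open Graph public

IsSSG : ∀ {n} → Graph n → Set
IsSSG {n} G =
  (Σ (Fin n) λ t → type G t ≡ term0 × ((v : Fin n) → type G v ≡ term0 → v ≡ t)) ×
  (Σ (Fin n) λ t → type G t ≡ term1 × ((v : Fin n) → type G v ≡ term1 → v ≡ t)) ×
  ((v : Fin n) → IsTerminal (type G v) → arcs G v ≡ []) ×
  ((v : Fin n) → ¬ IsTerminal (type G v) → length (arcs G v) ≡ 2)

Strategy : ∀ {n} → Graph n → NodeType → Set
Strategy {n} G X = (v : Fin n) → type G v ≡ X → Σ (Fin n) λ w → w ∈L arcs G v

data PlayEdge {n} (G : Graph n) (σ : Strategy G maxN) (τ : Strategy G minN)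
     : Fin n → Fin n → Set where
  maxE : ∀ {u w} (e : type G u ≡ maxN) → proj₁ (σ u e) ≡ w → PlayEdge G σ τ u w
  minE : ∀ {u w} (e : type G u ≡ minN) → proj₁ (τ u e) ≡ w → PlayEdge G σ τ u w
  avgE : ∀ {u w} → type G u ≡ avgN → w ∈L arcs G u → PlayEdge G σ τ u w

IsStoppingGame : ∀ {n} → Graph n → Set
IsStoppingGame {n} G =
  IsSSG G ×
  ((σ : Strategy G maxN) (τ : Strategy G minN) (v : Fin n) →
     Σ (Fin n) λ t → IsTerminal (type G t) × Star (PlayEdge G σ τ) v t)

countLow : ∀ {n} → Types n → (NodeType → Bool) → ℕ
countLow {n} T p = length (filterᵇ (λ v → (toℕ v <ᵇ n ∸ 3) ∧ p (T v)) (allFin n))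

ValidTypes : (a b c : ℕ) → Types (a + b + c + 2) → Set
ValidTypes a b c T =
  ((v : Fin n) → toℕ v ≡ n ∸ 1 → T v ≡ term1) ×
  ((v : Fin n) → toℕ v ≡ n ∸ 2 → T v ≡ term0) ×
  ((v : Fin n) → toℕ v ≡ n ∸ 3 → T v ≡ avgN) ×
  ((v : Fin n) → toℕ v < n ∸ 3 → T v ≡ avgN ⊎ T v ≡ minN ⊎ T v ≡ maxN) ×
  countLow T isAvg ≡ a ∸ 1 × countLow T isMin ≡ b × countLow T isMax ≡ c
  where n = a + b + c + 2

InitialArcs : ∀ {n} → Types n → Arcs n → Set
InitialArcs {n} T A =
  ((v : Fin n) → IsTerminal (T v) → A v ≡ []) ×
  ((v : Fin n) → ¬ IsTerminal (T v) → Σ (Fin n) λ w → toℕ v < toℕ w × A v ≡ w ∷ [])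

data Step3 {n} (T : Types n) : Arcs n → Arcs n → Set where
  step3 : ∀ {A} (m p q : Fin n) → T m ≡ avgN → A m ≡ p ∷ [] →
          q ≢ m → q ≢ p → Step3 T A (addArc A m q)

data Step4 {n} (T : Types n) : Arcs n → Arcs n → Set where
  step4 : ∀ {A} (m p q : Fin n) → IsPlayer (T m) → A m ≡ p ∷ [] →
          q ≢ m → q ≢ p → ¬ IsTerminal (T q) →
          NoBadSubgraph T (addArc A m q) → Step4 T A (addArc A m q)

Phase3Done : ∀ {n} → Types n → Arcs n → Set
Phase3Done {n} T A = (m : Fin n) → T m ≡ avgN → ¬ (∃ λ p → A m ≡ p ∷ [])

Phase4Done : ∀ {n} → Types n → Arcs n → Set
Phase4Done {n} T A = (m : Fin n) → IsPlayer (T m) → ¬ (∃ λ p → A m ≡ p ∷ [])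

-- G is a possible output of the generator with parameters (a,b,c)
Generated : (a b c : ℕ) → Graph (a + b + c + 2) → Set
Generated a b c G =
  Σ (Arcs n) λ A0 → Σ (Arcs n) λ A1 →
    ValidTypes a b c (type G) ×
    InitialArcs (type G) A0 ×
    Star (Step3 (type G)) A0 A1 × Phase3Done (type G) A1 ×
    Star (Step4 (type G)) A1 (arcs G) × Phase4Done (type G) (arcs G)
  where n = a + b + c + 2

{-# OPTIONS --safe #-}
-- Fix strategies σ, τ and a node v. In G_{σ,τ} the nodes reachable from v form a closed set;
-- if none of them is terminal, it contains a node w that every node reachable from w can
-- reach back, and the nodes reachable from w are then closed, strongly connected and
-- terminal-free. A player node of such a set keeps its chosen arc inside and an average node
-- all its arcs, so the set is a bad subgraph of the generated graph. The generator never
-- leaves one: since b ≥ 1, some min node still has a single arc after step (3), so step (4)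
-- runs at least once, and its last iteration guarantees that the output has no bad subgraph. The SSG shape holds because every step turns a node with one arc
-- into a node with two, and the terminals sit at the fixed positions n - 1 and n.
module Submission where

open import Defs
open import Level using (0ℓ)
open import Data.Nat using (ℕ; zero; suc; _+_; _≥_; _≤_; _<_; _∸_; s≤s; s≤s⁻¹; z≤n; z<s)
open import Data.Nat.Properties
  using (≤-trans; <-≤-trans; ≤-reflexive; <⇒≱; +-suc; +-monoʳ-≤; +-monoˡ-≤; m≤m+n; n≤1+n;
         m<1+n⇒m<n∨m≡n; ∸-monoʳ-<)
open import Data.Fin using (Fin; toℕ; fromℕ<; _≟_)
open import Data.Fin.Properties using (any?; toℕ<n; toℕ-fromℕ<; toℕ-injective)
open import Data.Fin.Subset using (Subset; _∈_; _∉_; _⊆_; _⊂_; _∪_; ⁅_⁆; ∣_∣; Nonempty)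
open import Data.Fin.Subset.Properties
  using (_∈?_; ∣p∣≤n; p⊂q⇒∣p∣<∣q∣; p⊆p∪q; x∈p∪q⁺; x∈p∪q⁻; x∈⁅x⁆; x∈⁅y⁆⇒x≡y)
open import Data.Product using (Σ; ∃; ∃₂; _×_; _,_; proj₁; proj₂)
open import Data.Sum using (_⊎_; inj₁; inj₂)
open import Data.Bool as Bool using (Bool; true; false)
open import Data.Bool.Properties using (T-∧)
open import Data.List using (List; []; _∷_; _++_; length; filterᵇ; allFin)
open import Data.List.Membership.Propositional using (lose) renaming (_∈_ to _∈L_)
open import Data.List.Relation.Unary.Any as Any using (Any; here)
open import Data.List.Relation.Unary.All as All using (All)
open import Data.Empty using (⊥-elim)
open import Function using (_∘_; id; Equivalence)
open import Relation.Nullary using (¬_; Dec; yes; no)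
open import Relation.Nullary.Decidable using (_×-dec_; ¬?; decidable-stable; map′)
open import Relation.Binary using (Rel; Decidable; _Respects_)
open import Relation.Binary.PropositionalEquality using (_≡_; _≢_; refl; sym; trans; cong; subst)
open import Relation.Binary.Construct.Closure.ReflexiveTransitive as Star using (Star; ε; _◅_; _◅◅_)

star-respects : ∀ {A : Set} {R : Rel A 0ℓ} {P : A → Set} → P Respects R → P Respects Star R
star-respects step ε = id
star-respects step (r ◅ rs) = star-respects step rs ∘ step r

empty-or-last : ∀ {A : Set} {R : Rel A 0ℓ} {x y} → Star R x y → x ≡ y ⊎ ∃ λ z → R z y
empty-or-last ε = inj₁ refl
empty-or-last (r ◅ rs) with empty-or-last rs
... | inj₁ refl = inj₂ (_ , r)
... | inj₂ last = inj₂ last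

module FiniteReachability {n : ℕ} {_⟶_ : Rel (Fin n) 0ℓ} (_⟶?_ : Decidable _⟶_) where

  _⟶*_ : Rel (Fin n) 0ℓ
  _⟶*_ = Star _⟶_

  Closed : Subset n → Set
  Closed S = ∀ {x y} → x ∈ S → x ⟶ y → y ∈ S

  closed-⟶* : ∀ {S x y} → Closed S → x ∈ S → x ⟶* y → y ∈ S
  closed-⟶* closed x∈S ε = x∈S
  closed-⟶* closed x∈S (x⟶z ◅ z⟶*y) = closed-⟶* closed (closed x∈S x⟶z) z⟶*y

  Exit : Subset n → Set
  Exit S = ∃₂ λ x y → x ∈ S × x ⟶ y × y ∉ S

  exit? : ∀ S → Dec (Exit S)
  exit? S = any? λ x → any? λ y → x ∈? S ×-dec x ⟶? y ×-dec ¬? (y ∈? S)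

  ¬exit⇒closed : ∀ {S} → ¬ Exit S → Closed S
  ¬exit⇒closed {S} ¬exit {x} {y} x∈S x⟶y =
    decidable-stable (y ∈? S) λ y∉S → ¬exit (x , y , x∈S , x⟶y , y∉S)

  saturate : ∀ k {u} S → n < k + ∣ S ∣ → (∀ {x} → x ∈ S → u ⟶* x) →
             ∃ λ R → S ⊆ R × Closed R × (∀ {x} → x ∈ R → u ⟶* x)
  saturate zero S n<∣S∣ _ = ⊥-elim (<⇒≱ n<∣S∣ (∣p∣≤n S))
  saturate (suc k) {u} S bound reached with exit? S
  ... | no ¬exit = S , id , ¬exit⇒closed ¬exit , reached
  ... | yes (x , y , x∈S , x⟶y , y∉S) with saturate k (S ∪ ⁅ y ⁆) bound′ reached′
    where
    S⊂S∪y : S ⊂ S ∪ ⁅ y ⁆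
    S⊂S∪y = p⊆p∪q ⁅ y ⁆ , y , x∈p∪q⁺ (inj₂ (x∈⁅x⁆ y)) , y∉S
    bound′ : n < k + ∣ S ∪ ⁅ y ⁆ ∣
    bound′ = <-≤-trans bound
               (≤-trans (≤-reflexive (sym (+-suc k ∣ S ∣))) (+-monoʳ-≤ k (p⊂q⇒∣p∣<∣q∣ S⊂S∪y)))
    reached′ : ∀ {z} → z ∈ S ∪ ⁅ y ⁆ → u ⟶* z
    reached′ {z} z∈ with x∈p∪q⁻ S ⁅ y ⁆ z∈
    ... | inj₁ z∈S = reached z∈S
    ... | inj₂ z∈⁅y⁆ rewrite x∈⁅y⁆⇒x≡y y z∈⁅y⁆ = reached x∈S ◅◅ (x⟶y ◅ ε)
  ... | R , S∪y⊆R , closed , sound = R , S∪y⊆R ∘ p⊆p∪q ⁅ y ⁆ , closed , sound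

  private
    reachableSet : ∀ u → ∃ λ R → ⁅ u ⁆ ⊆ R × Closed R × (∀ {x} → x ∈ R → u ⟶* x)
    reachableSet u = saturate (suc n) ⁅ u ⁆ (s≤s (m≤m+n n ∣ ⁅ u ⁆ ∣)) start
      where
      start : ∀ {x} → x ∈ ⁅ u ⁆ → u ⟶* x
      start x∈⁅u⁆ rewrite x∈⁅y⁆⇒x≡y u x∈⁅u⁆ = ε

  reachable : Fin n → Subset n
  reachable u = proj₁ (reachableSet u)

  reachable-closed : ∀ {u} → Closed (reachable u)
  reachable-closed {u} = proj₁ (proj₂ (proj₂ (reachableSet u)))

  reachable-sound : ∀ {u x} → x ∈ reachable u → u ⟶* x
  reachable-sound {u} = proj₂ (proj₂ (proj₂ (reachableSet u)))

  reachable-complete : ∀ {u x} → u ⟶* x → x ∈ reachable u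
  reachable-complete {u} = closed-⟶* reachable-closed (proj₁ (proj₂ (reachableSet u)) (x∈⁅x⁆ u))

  _⟶*?_ : Decidable _⟶*_
  u ⟶*? x = map′ reachable-sound reachable-complete (x ∈? reachable u)

  Recurrent : Fin n → Set
  Recurrent w = ∀ {x} → w ⟶* x → x ⟶* w

  reachable-⊂ : ∀ {u x} → u ⟶* x → ¬ (x ⟶* u) → reachable x ⊂ reachable u
  reachable-⊂ u⟶*x x↛u =
    (λ y∈ → reachable-complete (u⟶*x ◅◅ reachable-sound y∈)) ,
    _ , reachable-complete ε , x↛u ∘ reachable-sound

  recurrent-reachable′ : ∀ k u → ∣ reachable u ∣ < k → ∃ λ w → u ⟶* w × Recurrent w
  recurrent-reachable′ (suc k) u size with any? (λ x → u ⟶*? x ×-dec ¬? (x ⟶*? u))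
  ... | no ¬escape =
    u , ε , λ {x} u⟶*x → decidable-stable (x ⟶*? u) λ x↛u → ¬escape (x , u⟶*x , x↛u)
  ... | yes (x , u⟶*x , x↛u) with recurrent-reachable′ k x
                                    (<-≤-trans (p⊂q⇒∣p∣<∣q∣ (reachable-⊂ u⟶*x x↛u)) (s≤s⁻¹ size))
  ...   | w , x⟶*w , recurrent = w , u⟶*x ◅◅ x⟶*w , recurrent

  recurrent-reachable : ∀ u → ∃ λ w → u ⟶* w × Recurrent w
  recurrent-reachable u = recurrent-reachable′ (suc n) u (s≤s (∣p∣≤n (reachable u)))

  Within : Subset n → Rel (Fin n) 0ℓ
  Within S x y = x ∈ S × y ∈ S × x ⟶ y

  closed-⟶*-within : ∀ {S x y} → Closed S → x ∈ S → x ⟶* y → Star (Within S) x y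
  closed-⟶*-within closed x∈S ε = ε
  closed-⟶*-within closed x∈S (x⟶z ◅ z⟶*y) =
    (x∈S , closed x∈S x⟶z , x⟶z) ◅ closed-⟶*-within closed (closed x∈S x⟶z) z⟶*y

  recurrent-stronglyConnected : ∀ {w x y} → Recurrent w → x ∈ reachable w → y ∈ reachable w →
                                Star (Within (reachable w)) x y
  recurrent-stronglyConnected recurrent x∈ y∈ =
    closed-⟶*-within reachable-closed x∈ (recurrent (reachable-sound x∈) ◅◅ reachable-sound y∈)

nonTerminal : ∀ {t} → t ≡ avgN ⊎ t ≡ minN ⊎ t ≡ maxN → ¬ IsTerminal t
nonTerminal (inj₁ refl) = λ { (inj₁ ()) ; (inj₂ ()) }
nonTerminal (inj₂ (inj₁ refl)) = λ { (inj₁ ()) ; (inj₂ ()) }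
nonTerminal (inj₂ (inj₂ refl)) = λ { (inj₁ ()) ; (inj₂ ()) }

player-nonTerminal : ∀ {t} → IsPlayer t → ¬ IsTerminal t
player-nonTerminal (inj₁ max) = nonTerminal (inj₂ (inj₂ max))
player-nonTerminal (inj₂ min) = nonTerminal (inj₂ (inj₁ min))

player-nonAverage : ∀ {t} → IsPlayer t → t ≢ avgN
player-nonAverage (inj₁ refl) ()
player-nonAverage (inj₂ refl) ()

average-or-player : ∀ t → ¬ IsTerminal t → t ≡ avgN ⊎ IsPlayer t
average-or-player maxN _ = inj₂ (inj₁ refl)
average-or-player minN _ = inj₂ (inj₂ refl)
average-or-player avgN _ = inj₁ refl
average-or-player term0 nonTerminal = ⊥-elim (nonTerminal (inj₁ refl))
average-or-player term1 nonTerminal = ⊥-elim (nonTerminal (inj₂ refl))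

isTerminal? : ∀ t → Dec (IsTerminal t)
isTerminal? maxN = no (player-nonTerminal (inj₁ refl))
isTerminal? minN = no (player-nonTerminal (inj₂ refl))
isTerminal? avgN = no (nonTerminal (inj₁ refl))
isTerminal? term0 = yes (inj₁ refl)
isTerminal? term1 = yes (inj₂ refl)

module Play {n} (G : Graph n) (σ : Strategy G maxN) (τ : Strategy G minN) where

  -- Generalising over the type of u lets the clauses pass the equation on to σ and τ.
  movesOf : (u : Fin n) (t : NodeType) → type G u ≡ t → List (Fin n)
  movesOf u maxN e = proj₁ (σ u e) ∷ []
  movesOf u minN e = proj₁ (τ u e) ∷ []
  movesOf u avgN e = arcs G u
  movesOf u term0 e = []
  movesOf u term1 e = []

  moves : Fin n → List (Fin n)
  moves u = movesOf u (type G u) refl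

  _⟶_ : Rel (Fin n) 0ℓ
  u ⟶ w = w ∈L moves u

  _⟶?_ : Decidable _⟶_
  u ⟶? w = Any.any? (w ≟_) (moves u)

  move⇒playEdge : ∀ {u w} → u ⟶ w → PlayEdge G σ τ u w
  move⇒playEdge {u} = go (type G u) refl
    where
    go : ∀ {w} t (e : type G u ≡ t) → w ∈L movesOf u t e → PlayEdge G σ τ u w
    go maxN e (here w≡) = maxE e (sym w≡)
    go minN e (here w≡) = minE e (sym w≡)
    go avgN e w∈ = avgE e w∈

  move⇒arc : ∀ {u w} → u ⟶ w → w ∈L arcs G u
  move⇒arc {u} = go (type G u) refl
    where
    go : ∀ {w} t (e : type G u ≡ t) → w ∈L movesOf u t e → w ∈L arcs G u
    go maxN e (here refl) = proj₂ (σ u e)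
    go minN e (here refl) = proj₂ (τ u e)
    go avgN e w∈ = w∈

  player-hasMove : ∀ {u} → IsPlayer (type G u) → ∃ (u ⟶_)
  player-hasMove {u} = go (type G u) refl
    where
    go : ∀ t (e : type G u ≡ t) → IsPlayer t → ∃ λ w → w ∈L movesOf u t e
    go _ e (inj₁ refl) = _ , here refl
    go _ e (inj₂ refl) = _ , here refl

  average-arc⇒move : ∀ {u w} → type G u ≡ avgN → w ∈L arcs G u → u ⟶ w
  average-arc⇒move {u} = go (type G u) refl
    where
    go : ∀ {w} t (e : type G u ≡ t) → t ≡ avgN → w ∈L arcs G u → w ∈L movesOf u t e
    go _ e refl w∈ = w∈

  open FiniteReachability _⟶?_

  closed-stronglyConnected⇒bad :
    ∀ {S} → Nonempty S → Closed S → (∀ {x} → x ∈ S → ¬ IsTerminal (type G x)) →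
    (∀ {x y} → x ∈ S → y ∈ S → Star (Within S) x y) → IsBad (type G) (arcs G) S
  closed-stronglyConnected⇒bad {S} nonempty closed nonTerminal connected =
    nonempty ,
    (λ v v∈S → player-exits v∈S , average-exits v∈S , nonTerminal v∈S) ,
    (λ x y x∈S y∈S → Star.map withinArc (connected x∈S y∈S))
    where
    player-exits : ∀ {v} → v ∈ S → IsPlayer (type G v) → Any (_∈ S) (arcs G v)
    player-exits v∈S player with player-hasMove player
    ... | w , v⟶w = lose (move⇒arc v⟶w) (closed v∈S v⟶w)
    average-exits : ∀ {v} → v ∈ S → type G v ≡ avgN → All (_∈ S) (arcs G v)
    average-exits v∈S average = All.tabulate (closed v∈S ∘ average-arc⇒move average)
    withinArc : ∀ {x y} → Within S x y → EdgeIn (arcs G) S x y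
    withinArc (x∈S , y∈S , x⟶y) = x∈S , y∈S , move⇒arc x⟶y

  noBadSubgraph⇒stopping : NoBadSubgraph (type G) (arcs G) → ∀ v →
                           Σ (Fin n) λ t → IsTerminal (type G t) × Star (PlayEdge G σ τ) v t
  noBadSubgraph⇒stopping noBad v with any? (λ t → isTerminal? (type G t) ×-dec v ⟶*? t)
  ... | yes (t , terminal , v⟶*t) = t , terminal , Star.map move⇒playEdge v⟶*t
  ... | no ¬stops with recurrent-reachable v
  ...   | w , v⟶*w , recurrent = ⊥-elim (noBad (reachable w , bad))
    where
    bad : IsBad (type G) (arcs G) (reachable w)
    bad = closed-stronglyConnected⇒bad (w , reachable-complete ε) reachable-closed
            (λ x∈ terminal → ¬stops (_ , terminal , v⟶*w ◅◅ reachable-sound x∈))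
            (recurrent-stronglyConnected recurrent)

OneArc : ∀ {A : Set} → List A → Set
OneArc xs = ∃ λ p → xs ≡ p ∷ []

OneOrTwoArcs : ∀ {A : Set} → List A → Set
OneOrTwoArcs xs = OneArc xs ⊎ length xs ≡ 2

data AddsSecondArc {n} (P : Fin n → Set) : Rel (Arcs n) 0ℓ where
  addSecondArc : ∀ {A} m p q → P m → A m ≡ p ∷ [] → AddsSecondArc P A (addArc A m q)

step3⇒addsSecondArc : ∀ {n} {T : Types n} {A B} →
                      Step3 T A B → AddsSecondArc (λ m → T m ≡ avgN) A B
step3⇒addsSecondArc (step3 m p q average Am≡[p] _ _) = addSecondArc m p q average Am≡[p]

step4⇒addsSecondArc : ∀ {n} {T : Types n} {A B} →
                      Step4 T A B → AddsSecondArc (IsPlayer ∘ T) A B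
step4⇒addsSecondArc (step4 m p q player Am≡[p] _ _ _ _) = addSecondArc m p q player Am≡[p]

addsSecondArc-at : ∀ {n P} {A B : Arcs n} → AddsSecondArc P A B → ∀ v →
                   B v ≡ A v ⊎ P v × OneArc (A v) × length (B v) ≡ 2
addsSecondArc-at (addSecondArc m p q Pm Am≡[p]) v with v ≟ m
... | no _ = inj₁ refl
... | yes refl = inj₂ (Pm , (p , Am≡[p]) , cong (λ xs → length (xs ++ q ∷ [])) Am≡[p])

module _ {n} {P : Fin n → Set} where

  noArcs-respects : ∀ v → (λ A → A v ≡ []) Respects AddsSecondArc P
  noArcs-respects v step Av≡[] with addsSecondArc-at step v
  ... | inj₁ Bv≡Av = trans Bv≡Av Av≡[]
  ... | inj₂ (_ , (_ , Av≡[p]) , _) with () ← trans (sym Av≡[]) Av≡[p]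

  twoArcs-respects : ∀ v → (λ A → length (A v) ≡ 2) Respects AddsSecondArc P
  twoArcs-respects v step two with addsSecondArc-at step v
  ... | inj₁ Bv≡Av = trans (cong length Bv≡Av) two
  ... | inj₂ (_ , _ , two′) = two′

  oneOrTwoArcs-respects : ∀ v → (λ A → OneOrTwoArcs (A v)) Respects AddsSecondArc P
  oneOrTwoArcs-respects v step oneOrTwo with addsSecondArc-at step v
  ... | inj₁ Bv≡Av = subst OneOrTwoArcs (sym Bv≡Av) oneOrTwo
  ... | inj₂ (_ , _ , two) = inj₂ two

  unchanged-respects : ∀ {v xs} → ¬ P v → (λ A → A v ≡ xs) Respects AddsSecondArc P
  unchanged-respects {v} ¬Pv step Av≡xs with addsSecondArc-at step v
  ... | inj₁ Bv≡Av = trans Bv≡Av Av≡xs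
  ... | inj₂ (Pv , _) = ⊥-elim (¬Pv Pv)

oneOrTwo-¬one⇒two : ∀ {A : Set} {xs : List A} → OneOrTwoArcs xs → ¬ OneArc xs → length xs ≡ 2
oneOrTwo-¬one⇒two (inj₁ one) ¬one = ⊥-elim (¬one one)
oneOrTwo-¬one⇒two (inj₂ two) _ = two

module Generation {n} {T : Types n} {A₀ A₁ A : Arcs n}
  (initial : InitialArcs T A₀) (phase3 : Star (Step3 T) A₀ A₁) (done3 : Phase3Done T A₁)
  (phase4 : Star (Step4 T) A₁ A) (done4 : Phase4Done T A) where

  private
    phase3′ : Star (AddsSecondArc (λ m → T m ≡ avgN)) A₀ A₁
    phase3′ = Star.map step3⇒addsSecondArc phase3

    phase4′ : Star (AddsSecondArc (IsPlayer ∘ T)) A₁ A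
    phase4′ = Star.map step4⇒addsSecondArc phase4

  terminal-noArcs : ∀ v → IsTerminal (T v) → A v ≡ []
  terminal-noArcs v terminal =
    star-respects (noArcs-respects v) phase4′
      (star-respects (noArcs-respects v) phase3′ (proj₁ initial v terminal))

  initial-oneArc : ∀ v → ¬ IsTerminal (T v) → OneArc (A₀ v)
  initial-oneArc v nonTerminal with proj₂ initial v nonTerminal
  ... | w , _ , A₀v≡[w] = w , A₀v≡[w]

  phase3-oneOrTwoArcs : ∀ v → ¬ IsTerminal (T v) → OneOrTwoArcs (A₁ v)
  phase3-oneOrTwoArcs v nonTerminal =
    star-respects (oneOrTwoArcs-respects v) phase3′ (inj₁ (initial-oneArc v nonTerminal))

  nonTerminal-twoArcs : ∀ v → ¬ IsTerminal (T v) → length (A v) ≡ 2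
  nonTerminal-twoArcs v nonTerminal with average-or-player (T v) nonTerminal
  ... | inj₁ average =
    star-respects (twoArcs-respects v) phase4′
      (oneOrTwo-¬one⇒two (phase3-oneOrTwoArcs v nonTerminal) (done3 v average))
  ... | inj₂ player =
    oneOrTwo-¬one⇒two
      (star-respects (oneOrTwoArcs-respects v) phase4′ (phase3-oneOrTwoArcs v nonTerminal))
      (done4 v player)

  noBadSubgraph : ∀ {v} → IsPlayer (T v) → NoBadSubgraph T A
  noBadSubgraph {v} player with empty-or-last phase4
  ... | inj₂ (_ , step4 _ _ _ _ _ _ _ _ noBad) = noBad
  ... | inj₁ A₁≡A = ⊥-elim (done4 v player (subst (λ B → OneArc (B v)) A₁≡A oneArc))
    where
    oneArc : OneArc (A₁ v)
    oneArc with initial-oneArc v (player-nonTerminal player)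
    ... | w , A₀v≡[w] =
      w , star-respects (unchanged-respects (player-nonAverage player)) phase3′ A₀v≡[w]

unique-at : ∀ {n} (T : Types n) {X k} → k < n → (∀ v → toℕ v ≡ k → T v ≡ X) →
            (∀ v → T v ≡ X → toℕ v ≡ k) → Σ (Fin n) λ t → T t ≡ X × ((v : Fin n) → T v ≡ X → v ≡ t)
unique-at T k<n forced onlyThere =
  fromℕ< k<n , forced _ (toℕ-fromℕ< k<n) ,
  λ v Tv≡X → toℕ-injective (trans (onlyThere v Tv≡X) (sym (toℕ-fromℕ< k<n)))

lastThree : ∀ {n i} → 3 ≤ n → i < n → i < n ∸ 3 ⊎ i ≡ n ∸ 3 ⊎ i ≡ n ∸ 2 ⊎ i ≡ n ∸ 1
lastThree (s≤s (s≤s (s≤s _))) i<3+k with m<1+n⇒m<n∨m≡n i<3+k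
... | inj₂ i≡2+k = inj₂ (inj₂ (inj₂ i≡2+k))
... | inj₁ i<2+k with m<1+n⇒m<n∨m≡n i<2+k
...   | inj₂ i≡1+k = inj₂ (inj₂ (inj₁ i≡1+k))
...   | inj₁ i<1+k with m<1+n⇒m<n∨m≡n i<1+k
...     | inj₂ i≡k = inj₂ (inj₁ i≡k)
...     | inj₁ i<k = inj₁ i<k

module _ {a b c} {T : Types (a + b + c + 2)}
         (valid : ValidTypes a b c T) (3≤n : 3 ≤ a + b + c + 2) where

  private
    n = a + b + c + 2

    term1At : ∀ v → toℕ v ≡ n ∸ 1 → T v ≡ term1
    term1At = proj₁ valid

    term0At : ∀ v → toℕ v ≡ n ∸ 2 → T v ≡ term0
    term0At = proj₁ (proj₂ valid)

    averageAt : ∀ v → toℕ v ≡ n ∸ 3 → T v ≡ avgN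
    averageAt = proj₁ (proj₂ (proj₂ valid))

    lowTypes : ∀ v → toℕ v < n ∸ 3 → T v ≡ avgN ⊎ T v ≡ minN ⊎ T v ≡ maxN
    lowTypes = proj₁ (proj₂ (proj₂ (proj₂ valid)))

  terminal-position : ∀ v → IsTerminal (T v) → toℕ v ≡ n ∸ 2 ⊎ toℕ v ≡ n ∸ 1
  terminal-position v terminal with lastThree 3≤n (toℕ<n v)
  ... | inj₁ low = ⊥-elim (nonTerminal (lowTypes v low) terminal)
  ... | inj₂ (inj₁ at) = ⊥-elim (nonTerminal (inj₁ (averageAt v at)) terminal)
  ... | inj₂ (inj₂ at) = at

  term0-unique : Σ (Fin n) λ t → T t ≡ term0 × ((v : Fin n) → T v ≡ term0 → v ≡ t)
  term0-unique = unique-at T (∸-monoʳ-< z<s (≤-trans (n≤1+n 2) 3≤n)) term0At position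
    where
    position : ∀ v → T v ≡ term0 → toℕ v ≡ n ∸ 2
    position v Tv≡term0 with terminal-position v (inj₁ Tv≡term0)
    ... | inj₁ at = at
    ... | inj₂ at with () ← trans (sym Tv≡term0) (term1At v at)

  term1-unique : Σ (Fin n) λ t → T t ≡ term1 × ((v : Fin n) → T v ≡ term1 → v ≡ t)
  term1-unique = unique-at T (∸-monoʳ-< z<s (≤-trans (s≤s z≤n) 3≤n)) term1At position
    where
    position : ∀ v → T v ≡ term1 → toℕ v ≡ n ∸ 1
    position v Tv≡term1 with terminal-position v (inj₂ Tv≡term1)
    ... | inj₁ at with () ← trans (sym Tv≡term1) (term0At v at)
    ... | inj₂ at = at

filterᵇ-witness : ∀ {A : Set} (p : A → Bool) xs →
                  0 < length (filterᵇ p xs) → ∃ λ x → Bool.T (p x)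
filterᵇ-witness p (x ∷ xs) positive with p x in px
... | true = x , subst Bool.T (sym px) _
... | false = filterᵇ-witness p xs positive

isMin-sound : ∀ t → Bool.T (isMin t) → t ≡ minN
isMin-sound minN _ = refl

minNode : ∀ {a b c} {T : Types (a + b + c + 2)} → ValidTypes a b c T → b ≥ 1 → ∃ λ v → T v ≡ minN
minNode {T = T} (_ , _ , _ , _ , _ , countMin , _) b≥1
  with filterᵇ-witness _ (allFin _) (subst (0 <_) (sym countMin) b≥1)
... | v , lowMin = v , isMin-sound (T v) (proj₂ (Equivalence.to T-∧ lowMin))

mainTheorem4 : (a b c : ℕ) → a ≥ 1 → b ≥ 1 → c ≥ 1 →
    (G : Graph (a + b + c + 2)) → Generated a b c G → IsStoppingGame G
mainTheorem4 a b c a≥1 b≥1 _ G (A₀ , A₁ , valid , initial , phase3 , done3 , phase4 , done4) =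
  (term0-unique valid 3≤n , term1-unique valid 3≤n , terminal-noArcs , nonTerminal-twoArcs) ,
  λ σ τ → Play.noBadSubgraph⇒stopping G σ τ (noBadSubgraph (inj₂ (proj₂ (minNode valid b≥1))))
  where
  open Generation initial phase3 done3 phase4 done4
  3≤n : 3 ≤ a + b + c + 2
  3≤n = +-monoˡ-≤ 2 (≤-trans a≥1 (≤-trans (m≤m+n a b) (m≤m+n (a + b) c)))
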